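{- Let $0\le s<t$ be integers and $G$ a graph. Then $G\in\mathscr{M}_t$ if and only if $K_s\ast G\in\mathscr{M}_{t-s}$.
   Context: All graphs are finite and simple with nonempty vertex set. By convention $K_1$ and $K_2$ are regarded as Hamiltonian (in addition to graphs with a Hamiltonian cycle). $G\ast H$ is the join ($G\sqcup H$ plus all edges between $V(G)$ and $V(H)$); $K_0$ is the empty graph so $K_0\ast G=G$. $\check{\mu}(G)=\min\{l\in\mathbb{N}_0: K_l\ast G\text{ is Hamiltonian}\}$. For $t\ge0$, $\mathscr{M}_t$ is the set of graphs $G$ with $\check{\mu}(G)=t$ and $\check{\mu}(G+e)<t$ for every non-edge $e$ of $G$ (edge of the complement $\overline{G}$). -}

module Defs where

open import Data.Nat using (ℕ; zero; suc; _+_; _<_; _≤_)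
open import Data.Fin using (Fin; zero; suc; inject₁; fromℕ; splitAt; _≟_)
open import Data.Fin.Permutation using (Permutation′; _⟨$⟩ʳ_)
open import Data.Bool using (Bool; true; false; not; _∧_; _∨_)
open import Data.Sum using (_⊎_; inj₁; inj₂)
open import Data.Product using (Σ; _×_; ∃-syntax)
open import Relation.Nullary using (¬_)
open import Relation.Nullary.Decidable using (⌊_⌋)
open import Relation.Binary.PropositionalEquality using (_≡_; _≢_)

record Graph : Set where
  constructor mkGraph
  field
    size : ℕ
    adj  : Fin size → Fin size → Bool
open Graph public

record IsSimple (G : Graph) : Set where
  field
    nonempty : 1 ≤ size G
    symm     : ∀ i j → adj G i j ≡ adj G j i
    irrefl   : ∀ i → adj G i i ≡ false

HasHamCycle : (n : ℕ) → (Fin n → Fin n → Bool) → Set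
HasHamCycle (suc (suc (suc m))) a =
  Σ (Permutation′ (suc (suc (suc m)))) λ σ →
    (∀ (i : Fin (suc (suc m))) → a (σ ⟨$⟩ʳ inject₁ i) (σ ⟨$⟩ʳ suc i) ≡ true)
    × a (σ ⟨$⟩ʳ fromℕ (suc (suc m))) (σ ⟨$⟩ʳ zero) ≡ true
HasHamCycle _ a = Data.Empty.⊥
  where import Data.Empty

Hamiltonian : Graph → Set
Hamiltonian G =
  (size G ≡ 1)
  ⊎ (Σ (size G ≡ 2) λ _ → ∃[ u ] ∃[ v ] (u ≢ v × adj G u v ≡ true))
  ⊎ HasHamCycle (size G) (adj G)

join : ℕ → Graph → Graph
join l G = mkGraph (l + size G) a
  where
  a : Fin (l + size G) → Fin (l + size G) → Bool
  a i j with splitAt l i | splitAt l j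
  ... | inj₁ x | inj₁ y = not ⌊ x ≟ y ⌋
  ... | inj₁ _ | inj₂ _ = true
  ... | inj₂ _ | inj₁ _ = true
  ... | inj₂ x | inj₂ y = adj G x y

addEdge : (G : Graph) → Fin (size G) → Fin (size G) → Graph
addEdge G u v = mkGraph (size G) λ i j →
  adj G i j ∨ ((⌊ i ≟ u ⌋ ∧ ⌊ j ≟ v ⌋) ∨ (⌊ i ≟ v ⌋ ∧ ⌊ j ≟ u ⌋))

MuIs : Graph → ℕ → Set
MuIs G t = Hamiltonian (join t G) × (∀ l → l < t → ¬ Hamiltonian (join l G))

InM : ℕ → Graph → Set
InM t G =
  MuIs G t ×
  (∀ u v → u ≢ v → adj G u v ≡ false →
     ∃[ t' ] (t' < t × MuIs (addEdge G u v) t'))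

-- Write μ̌ for the least l with K_l ∗ G Hamiltonian. Since K_l ∗ (K_s ∗ G) = K_(l+s) ∗ G and
-- adding a vertex adjacent to everything preserves Hamiltonicity (so the set of such l is
-- upward closed), μ̌(K_s ∗ G) = μ̌(G) ∸ s, and conversely μ̌(G) = μ̌(K_s ∗ G) + s when s < μ̌(G).
-- The non-edges of K_s ∗ G are exactly the non-edges of G, and adding one commutes with the
-- join, so the criticality condition μ̌(G + e) < t transfers to μ̌((K_s ∗ G) + e) < t ∸ s and
-- back; the backward direction needs μ̌(G + e) to exist, which holds because Hamiltonicity is
-- decidable.

module Submission where

open import Defs
import Data.Nat as ℕ
open import Data.Nat using (ℕ; zero; suc; _+_; _∸_; _≤_; _<_; _≤′_; ≤′-step; ≤′-refl; s≤s)
open import Data.Nat.Properties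
  using (+-comm; ≤-refl; ≤-trans; ≤-reflexive; <⇒≤; ≤-<-trans; ≤⇒≤′; n≮0; m≤n+m∸n; m∸n+n≡m;
         m∸n≢0⇒n<m; m≤o∸n⇒m+n≤o; m<n⇒0<n∸m; anyUpTo?)
open import Data.Nat.Induction using (<-rec)
open import Data.Fin using (Fin; zero; suc; cast; inject₁; fromℕ; splitAt; punchIn; _↑ˡ_; _↑ʳ_; _≟_)
open import Data.Fin.Properties
  using (cast-is-id; any?; all?; splitAt-↑ˡ; splitAt-↑ʳ; splitAt⁻¹-↑ˡ; splitAt⁻¹-↑ʳ;
         suc-injective; ↑ʳ-injective)
open import Data.Fin.Permutation
  using (Permutation′; _⟨$⟩ʳ_; lift₀; insert; remove; insert-remove; reverse)
import Data.Fin.Permutation as Perm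
open import Data.Vec.Functional using (_∷_)
open import Data.Bool using (Bool; true; false; not)
open import Data.Bool.Properties using (∨-identityʳ)
import Data.Bool.Properties as Bool
open import Data.Sum using (inj₁; inj₂)
open import Data.Product using (_×_; _,_; ∃; ∃₂; ∃-syntax)
open import Function using (_∘_)
open import Function.Bundles using (_⇔_; mk⇔; Equivalence)
open import Relation.Nullary using (¬_; Dec; yes; no; contradiction)
open import Relation.Nullary.Decidable using (⌊_⌋; _×-dec_; _⊎-dec_; ¬?; map′)
open import Relation.Unary using (Decidable)
open import Relation.Binary.PropositionalEquality
  using (_≡_; _≢_; _≗_; refl; sym; trans; cong; cong₂; subst)

open Equivalence using (to; from)

-- Sizes such as l + (s + n) and (l + s) + n are only propositionally equal, so graphs are
-- compared along a cast of the vertex set.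
infix 4 _≅_

record _≅_ (G H : Graph) : Set where
  field
    size-≡ : size G ≡ size H
    adj-≡  : ∀ i j → adj G i j ≡ adj H (cast size-≡ i) (cast size-≡ j)

cast-refl₂ : ∀ {n} (a : Fin n → Fin n → Bool) i j → a (cast refl i) (cast refl j) ≡ a i j
cast-refl₂ a i j = cong₂ a (cast-is-id refl i) (cast-is-id refl j)

≅-pointwise : ∀ {n} {a b : Fin n → Fin n → Bool} → (∀ i j → a i j ≡ b i j) →
              mkGraph n a ≅ mkGraph n b
≅-pointwise {b = b} a≗b =
  record { size-≡ = refl ; adj-≡ = λ i j → trans (a≗b i j) (sym (cast-refl₂ b i j)) }

uncast₂ : ∀ {n} {a b : Fin n → Fin n → Bool} →
          (∀ i j → a i j ≡ b (cast refl i) (cast refl j)) → ∀ i j → a i j ≡ b i j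
uncast₂ {b = b} e i j = trans (e i j) (cast-refl₂ b i j)

≅-refl : ∀ {G} → G ≅ G
≅-refl = ≅-pointwise λ _ _ → refl

≅-sym : ∀ {G H} → G ≅ H → H ≅ G
≅-sym {mkGraph n a} {mkGraph .n b} record { size-≡ = refl ; adj-≡ = e } =
  ≅-pointwise λ i j → sym (uncast₂ e i j)

≅-trans : ∀ {G H K} → G ≅ H → H ≅ K → G ≅ K
≅-trans {mkGraph n a} {mkGraph .n b} {mkGraph .n c}
        record { size-≡ = refl ; adj-≡ = e } record { size-≡ = refl ; adj-≡ = f } =
  ≅-pointwise λ i j → trans (uncast₂ e i j) (uncast₂ f i j)

HasHamCycle-cong : ∀ n {a b : Fin n → Fin n → Bool} → (∀ i j → a i j ≡ b i j) →
                   HasHamCycle n a → HasHamCycle n b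
HasHamCycle-cong (suc (suc (suc _))) a≗b (σ , path , closing) =
  σ , (λ i → trans (sym (a≗b _ _)) (path i)) , trans (sym (a≗b _ _)) closing

Hamiltonian-cong : ∀ {n} {a b : Fin n → Fin n → Bool} → (∀ i j → a i j ≡ b i j) →
                   Hamiltonian (mkGraph n a) → Hamiltonian (mkGraph n b)
Hamiltonian-cong a≗b (inj₁ n≡1) = inj₁ n≡1
Hamiltonian-cong a≗b (inj₂ (inj₁ (n≡2 , u , v , u≢v , uv))) =
  inj₂ (inj₁ (n≡2 , u , v , u≢v , trans (sym (a≗b u v)) uv))
Hamiltonian-cong {n} a≗b (inj₂ (inj₂ cycle)) = inj₂ (inj₂ (HasHamCycle-cong n a≗b cycle))

Hamiltonian-resp-≅ : ∀ {G H} → G ≅ H → Hamiltonian G → Hamiltonian H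
Hamiltonian-resp-≅ {mkGraph n a} {mkGraph .n b} record { size-≡ = refl ; adj-≡ = e } =
  Hamiltonian-cong (uncast₂ e)

⌊≟⌋-injection : ∀ {m n} {f : Fin m → Fin n} → (∀ {x y} → f x ≡ f y → x ≡ y) →
                ∀ x y → ⌊ f x ≟ f y ⌋ ≡ ⌊ x ≟ y ⌋
⌊≟⌋-injection {f = f} f-injective x y with x ≟ y | f x ≟ f y
... | yes _   | yes _     = refl
... | yes x≡y | no fx≢fy  = contradiction (cong f x≡y) fx≢fy
... | no x≢y  | yes fx≡fy = contradiction (f-injective fx≡fy) x≢y
... | no _    | no _      = refl

not⌊≟⌋≡false⇒≡ : ∀ {n} (x y : Fin n) → not ⌊ x ≟ y ⌋ ≡ false → x ≡ y
not⌊≟⌋≡false⇒≡ x y _ with x ≟ y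
... | yes x≡y = x≡y
not⌊≟⌋≡false⇒≡ x y () | no _

join-cong : ∀ l {n} {a b : Fin n → Fin n → Bool} → (∀ i j → a i j ≡ b i j) →
            ∀ i j → adj (join l (mkGraph n a)) i j ≡ adj (join l (mkGraph n b)) i j
join-cong l a≗b i j with splitAt l i | splitAt l j
... | inj₁ _ | inj₁ _ = refl
... | inj₁ _ | inj₂ _ = refl
... | inj₂ _ | inj₁ _ = refl
... | inj₂ x | inj₂ y = a≗b x y

join-resp-≅ : ∀ l {G H} → G ≅ H → join l G ≅ join l H
join-resp-≅ l {mkGraph n a} {mkGraph .n b} record { size-≡ = refl ; adj-≡ = e } =
  ≅-pointwise (join-cong l (uncast₂ e))

join-suc : ∀ l G → join (suc l) G ≅ join 1 (join l G)
join-suc l G = ≅-pointwise adj-join-suc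
  where
  adj-join-suc : ∀ i j → adj (join (suc l) G) i j ≡ adj (join 1 (join l G)) i j
  adj-join-suc zero    zero    = refl
  adj-join-suc zero    (suc j) with splitAt l j
  ... | inj₁ _ = refl
  ... | inj₂ _ = refl
  adj-join-suc (suc i) zero    with splitAt l i
  ... | inj₁ _ = refl
  ... | inj₂ _ = refl
  adj-join-suc (suc i) (suc j) with splitAt l i | splitAt l j
  ... | inj₁ x | inj₁ y = cong not (⌊≟⌋-injection suc-injective x y)
  ... | inj₁ _ | inj₂ _ = refl
  ... | inj₂ _ | inj₁ _ = refl
  ... | inj₂ _ | inj₂ _ = refl

join-assoc : ∀ l s G → join l (join s G) ≅ join (l + s) G
join-assoc zero    s G = ≅-refl
join-assoc (suc l) s G =
  ≅-trans (join-suc l (join s G))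
          (≅-trans (join-resp-≅ 1 (join-assoc l s G)) (≅-sym (join-suc (l + s) G)))

Hamiltonian-join-join : ∀ l s G → Hamiltonian (join l (join s G)) ⇔ Hamiltonian (join (l + s) G)
Hamiltonian-join-join l s G =
  mk⇔ (Hamiltonian-resp-≅ (join-assoc l s G)) (Hamiltonian-resp-≅ (≅-sym (join-assoc l s G)))

data JoinVertex (s n : ℕ) : Fin (s + n) → Set where
  clique : (x : Fin s) → JoinVertex s n (x ↑ˡ n)
  base   : (y : Fin n) → JoinVertex s n (s ↑ʳ y)

joinVertex : ∀ s n i → JoinVertex s n i
joinVertex s n i with splitAt s i in eq
... | inj₁ x = subst (JoinVertex s n) (splitAt⁻¹-↑ˡ eq) (clique x)
... | inj₂ y = subst (JoinVertex s n) (splitAt⁻¹-↑ʳ eq) (base y)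

↑ˡ≢↑ʳ : ∀ {s n} (x : Fin s) (y : Fin n) → x ↑ˡ n ≢ s ↑ʳ y
↑ˡ≢↑ʳ {s} {n} x y eq
  with trans (sym (splitAt-↑ˡ s x n)) (trans (cong (splitAt s) eq) (splitAt-↑ʳ s n y))
... | ()

module _ (s : ℕ) (G : Graph) where
  private n = size G

  adj-join-clique-clique : ∀ x y → adj (join s G) (x ↑ˡ n) (y ↑ˡ n) ≡ not ⌊ x ≟ y ⌋
  adj-join-clique-clique x y rewrite splitAt-↑ˡ s x n | splitAt-↑ˡ s y n = refl

  adj-join-clique-base : ∀ x y → adj (join s G) (x ↑ˡ n) (s ↑ʳ y) ≡ true
  adj-join-clique-base x y rewrite splitAt-↑ˡ s x n | splitAt-↑ʳ s n y = refl

  adj-join-base-clique : ∀ x y → adj (join s G) (s ↑ʳ x) (y ↑ˡ n) ≡ true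
  adj-join-base-clique x y rewrite splitAt-↑ʳ s n x | splitAt-↑ˡ s y n = refl

  adj-join-base-base : ∀ x y → adj (join s G) (s ↑ʳ x) (s ↑ʳ y) ≡ adj G x y
  adj-join-base-base x y rewrite splitAt-↑ʳ s n x | splitAt-↑ʳ s n y = refl

NonEdge : (G : Graph) → Fin (size G) → Fin (size G) → Set
NonEdge G u v = u ≢ v × adj G u v ≡ false

nonEdge-join : ∀ s G {u v} → NonEdge G u v → NonEdge (join s G) (s ↑ʳ u) (s ↑ʳ v)
nonEdge-join s G {u} {v} (u≢v , uv∉) =
  u≢v ∘ ↑ʳ-injective s u v , trans (adj-join-base-base s G u v) uv∉

nonEdge-join⁻ : ∀ s G {u v} → NonEdge (join s G) u v →
                ∃₂ λ u′ v′ → u ≡ s ↑ʳ u′ × v ≡ s ↑ʳ v′ × NonEdge G u′ v′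
nonEdge-join⁻ s G {u} {v} (u≢v , uv∉) with joinVertex s (size G) u | joinVertex s (size G) v
... | clique x | clique y =
  contradiction (cong (_↑ˡ size G) (not⌊≟⌋≡false⇒≡ x y xy∉)) u≢v
  where xy∉ = trans (sym (adj-join-clique-clique s G x y)) uv∉
... | clique x | base y = contradiction (trans (sym (adj-join-clique-base s G x y)) uv∉) λ ()
... | base x | clique y = contradiction (trans (sym (adj-join-base-clique s G x y)) uv∉) λ ()
... | base x | base y =
  x , y , refl , refl , u≢v ∘ cong (s ↑ʳ_) , trans (sym (adj-join-base-base s G x y)) uv∉

join-addEdge : ∀ s G u v → join s (addEdge G u v) ≅ addEdge (join s G) (s ↑ʳ u) (s ↑ʳ v)
join-addEdge s G u v = ≅-pointwise adj-join-addEdge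
  where
  n = size G
  G+uv = addEdge G u v

  ⌊↑ʳ≟↑ʳ⌋ : ∀ x y → ⌊ s ↑ʳ x ≟ s ↑ʳ y ⌋ ≡ ⌊ x ≟ y ⌋
  ⌊↑ʳ≟↑ʳ⌋ = ⌊≟⌋-injection (↑ʳ-injective s _ _)

  ⌊↑ˡ≟↑ʳ⌋ : ∀ x y → ⌊ x ↑ˡ n ≟ s ↑ʳ y ⌋ ≡ false
  ⌊↑ˡ≟↑ʳ⌋ x y with x ↑ˡ n ≟ s ↑ʳ y
  ... | yes eq = contradiction eq (↑ˡ≢↑ʳ x y)
  ... | no _   = refl

  adj-join-addEdge : ∀ i j → adj (join s G+uv) i j ≡ adj (addEdge (join s G) (s ↑ʳ u) (s ↑ʳ v)) i j
  adj-join-addEdge i j with joinVertex s n i | joinVertex s n j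
  ... | clique x | clique y
    rewrite adj-join-clique-clique s G+uv x y | adj-join-clique-clique s G x y
          | ⌊↑ˡ≟↑ʳ⌋ x u | ⌊↑ˡ≟↑ʳ⌋ x v = sym (∨-identityʳ _)
  ... | clique x | base y
    rewrite adj-join-clique-base s G+uv x y | adj-join-clique-base s G x y = refl
  ... | base x | clique y
    rewrite adj-join-base-clique s G+uv x y | adj-join-base-clique s G x y = refl
  ... | base x | base y
    rewrite adj-join-base-base s G+uv x y | adj-join-base-base s G x y
          | ⌊↑ʳ≟↑ʳ⌋ x u | ⌊↑ʳ≟↑ʳ⌋ y v | ⌊↑ʳ≟↑ʳ⌋ x v | ⌊↑ʳ≟↑ʳ⌋ y u = refl

-- The new vertex is put in front of the cycle; K₂ becomes a triangle, run backwards if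
-- its edge is given as (1, 0).
Hamiltonian-join₁ : ∀ G → Hamiltonian G → Hamiltonian (join 1 G)
Hamiltonian-join₁ (mkGraph n a) (inj₁ refl) = inj₂ (inj₁ (refl , zero , suc zero , (λ ()) , refl))
Hamiltonian-join₁ (mkGraph n a) (inj₂ (inj₁ (refl , zero , suc zero , _ , edge))) =
  inj₂ (inj₂ (Perm.id , (λ { zero → refl ; (suc zero) → edge }) , refl))
Hamiltonian-join₁ (mkGraph n a) (inj₂ (inj₁ (refl , suc zero , zero , _ , edge))) =
  inj₂ (inj₂ (reverse , (λ { zero → edge ; (suc zero) → refl }) , refl))
Hamiltonian-join₁ (mkGraph n a) (inj₂ (inj₁ (refl , zero , zero , u≢v , _)))         = contradiction refl u≢v
Hamiltonian-join₁ (mkGraph n a) (inj₂ (inj₁ (refl , suc zero , suc zero , u≢v , _))) =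
  contradiction refl u≢v
Hamiltonian-join₁ (mkGraph (suc (suc (suc _))) a) (inj₂ (inj₂ (σ , path , closing))) =
  inj₂ (inj₂ (lift₀ σ , (λ { zero → refl ; (suc i) → path i }) , refl))

Hamiltonian-join-mono : ∀ {l k} G → l ≤ k → Hamiltonian (join l G) → Hamiltonian (join k G)
Hamiltonian-join-mono G = go ∘ ≤⇒≤′
  where
  go : ∀ {l k} → l ≤′ k → Hamiltonian (join l G) → Hamiltonian (join k G)
  go ≤′-refl       ham = ham
  go (≤′-step l≤k) ham =
    Hamiltonian-resp-≅ (≅-sym (join-suc _ G)) (Hamiltonian-join₁ _ (go l≤k ham))

∃-permutation? : ∀ n {Q : (Fin n → Fin n) → Set} → (∀ {f g} → f ≗ g → Q f → Q g) →
                 (∀ f → Dec (Q f)) → Dec (∃ λ (π : Permutation′ n) → Q (π ⟨$⟩ʳ_))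
∃-permutation? zero Q-resp Q? with Q? (λ ())
... | yes q = yes (Perm.id , Q-resp (λ ()) q)
... | no ¬q = no λ (_ , q) → ¬q (Q-resp (λ ()) q)
∃-permutation? (suc n) {Q} Q-resp Q? =
  map′ from-insert to-insert (any? λ j → ∃-permutation? n (Q-resp ∘ cons-cong j) (Q? ∘ cons j))
  where
  cons : Fin (suc n) → (Fin n → Fin n) → Fin (suc n) → Fin (suc n)
  cons j g = j ∷ punchIn j ∘ g

  cons-cong : ∀ j {f g} → f ≗ g → cons j f ≗ cons j g
  cons-cong j f≗g zero    = refl
  cons-cong j f≗g (suc i) = cong (punchIn j) (f≗g i)

  insert-cons : ∀ j ρ → insert zero j ρ ⟨$⟩ʳ_ ≗ cons j (ρ ⟨$⟩ʳ_)
  insert-cons j ρ zero    = refl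
  insert-cons j ρ (suc i) = refl

  from-insert : (∃ λ j → ∃ λ ρ → Q (cons j (ρ ⟨$⟩ʳ_))) → ∃ λ π → Q (π ⟨$⟩ʳ_)
  from-insert (j , ρ , q) = insert zero j ρ , Q-resp (sym ∘ insert-cons j ρ) q

  to-insert : (∃ λ π → Q (π ⟨$⟩ʳ_)) → ∃ λ j → ∃ λ ρ → Q (cons j (ρ ⟨$⟩ʳ_))
  to-insert (π , q) =
    π ⟨$⟩ʳ zero , remove zero π ,
    Q-resp (λ i → trans (sym (insert-remove zero π i)) (insert-cons _ _ i)) q

hasHamCycle? : ∀ n a → Dec (HasHamCycle n a)
hasHamCycle? zero                a = no λ ()
hasHamCycle? (suc zero)          a = no λ ()
hasHamCycle? (suc (suc zero))    a = no λ ()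
hasHamCycle? (suc (suc (suc m))) a = ∃-permutation? _ cycle-resp cycle?
  where
  Cycle : (Fin (suc (suc (suc m))) → Fin (suc (suc (suc m)))) → Set
  Cycle f = (∀ i → a (f (inject₁ i)) (f (suc i)) ≡ true)
          × a (f (fromℕ (suc (suc m)))) (f zero) ≡ true

  cycle-resp : ∀ {f g} → f ≗ g → Cycle f → Cycle g
  cycle-resp f≗g (path , closing) =
    (λ i → trans (cong₂ a (sym (f≗g _)) (sym (f≗g _))) (path i)) ,
    trans (cong₂ a (sym (f≗g _)) (sym (f≗g _))) closing

  cycle? : ∀ f → Dec (Cycle f)
  cycle? f = all? (λ i → a (f (inject₁ i)) (f (suc i)) Bool.≟ true)
             ×-dec (a (f (fromℕ (suc (suc m)))) (f zero) Bool.≟ true)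

hamiltonian? : ∀ G → Dec (Hamiltonian G)
hamiltonian? G =
  size G ℕ.≟ 1
  ⊎-dec (size G ℕ.≟ 2 ×-dec any? λ u → any? λ v → ¬? (u ≟ v) ×-dec adj G u v Bool.≟ true)
  ⊎-dec hasHamCycle? (size G) (adj G)

Least : (ℕ → Set) → ℕ → Set
Least P m = P m × (∀ l → l < m → ¬ P l)

least-witness : ∀ {P : ℕ → Set} → Decidable P → ∀ k → P k → ∃ λ m → m ≤ k × Least P m
least-witness {P} P? = <-rec _ search
  where
  search : ∀ k → (∀ {l} → l < k → P l → ∃ λ m → m ≤ l × Least P m) → P k → ∃ λ m → m ≤ k × Least P m
  search k below pk with anyUpTo? P? k
  ... | yes (l , l<k , pl) =
    let (m , m≤l , least) = below l<k pl in m , ≤-trans m≤l (<⇒≤ l<k) , least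
  ... | no none            = k , ≤-refl , pk , λ l l<k pl → none (l , l<k , pl)

m≤m∸n+n : ∀ m n → m ≤ m ∸ n + n
m≤m∸n+n m n = ≤-trans (m≤n+m∸n m n) (≤-reflexive (+-comm n (m ∸ n)))

m<o∸n⇒m+n<o : ∀ {m n o} → m < o ∸ n → m + n < o
m<o∸n⇒m+n<o {m} {n} {o} m<o∸n = m≤o∸n⇒m+n≤o (suc m) n≤o m<o∸n
  where
  n≤o : n ≤ o
  n≤o = <⇒≤ (m∸n≢0⇒n<m λ o∸n≡0 → n≮0 (subst (m <_) o∸n≡0 m<o∸n))

m<o⇒n<o⇒m∸n<o∸n : ∀ {m n o} → m < o → n < o → m ∸ n < o ∸ n
m<o⇒n<o⇒m∸n<o∸n {n = zero}  m<o _ = m<o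
m<o⇒n<o⇒m∸n<o∸n {zero}  {suc n} _ n<o = m<n⇒0<n∸m n<o
m<o⇒n<o⇒m∸n<o∸n {suc m} {suc n} (s≤s m<o) (s≤s n<o) = m<o⇒n<o⇒m∸n<o∸n m<o n<o

MuIs-resp-≅ : ∀ {G H m} → G ≅ H → MuIs G m → MuIs H m
MuIs-resp-≅ G≅H (ham , below) =
  Hamiltonian-resp-≅ (join-resp-≅ _ G≅H) ham ,
  λ l l<m → below l l<m ∘ Hamiltonian-resp-≅ (join-resp-≅ l (≅-sym G≅H))

MuIs-exists : ∀ H k → Hamiltonian (join k H) → ∃ λ m → m ≤ k × MuIs H m
MuIs-exists H = least-witness (λ l → hamiltonian? (join l H))

MuIs-join : ∀ s {H m} → MuIs H m → MuIs (join s H) (m ∸ s)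
MuIs-join s {H} {m} (ham , below) =
  from (Hamiltonian-join-join (m ∸ s) s H) (Hamiltonian-join-mono H (m≤m∸n+n m s) ham) ,
  λ l l<m∸s → below (l + s) (m<o∸n⇒m+n<o l<m∸s) ∘ to (Hamiltonian-join-join l s H)

MuIs-join⁻ : ∀ s {H m} → s < m → MuIs (join s H) (m ∸ s) → MuIs H m
MuIs-join⁻ s {H} {m} s<m (ham , below) =
  subst (λ k → Hamiltonian (join k H)) (m∸n+n≡m (<⇒≤ s<m))
        (to (Hamiltonian-join-join (m ∸ s) s H) ham) ,
  λ l l<m → below (l ∸ s) (m<o⇒n<o⇒m∸n<o∸n l<m s<m)
          ∘ from (Hamiltonian-join-join (l ∸ s) s H) ∘ Hamiltonian-join-mono H (m≤m∸n+n l s)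

MuIs-join-bound : ∀ s {H m} → MuIs (join s H) m → ∃ λ k → k ≤ m + s × MuIs H k
MuIs-join-bound s {H} {m} (ham , _) = MuIs-exists H (m + s) (to (Hamiltonian-join-join m s H) ham)

proposition3p1 : (s t : ℕ) → s < t → (G : Graph) → IsSimple G →
    InM t G ⇔ InM (t ∸ s) (join s G)
proposition3p1 s t s<t G _ = mk⇔ forward backward
  where
  forward : InM t G → InM (t ∸ s) (join s G)
  forward (μ̌G , critical) = MuIs-join s μ̌G , critical′
    where
    critical′ : ∀ u v → u ≢ v → adj (join s G) u v ≡ false →
                ∃[ t′ ] (t′ < t ∸ s × MuIs (addEdge (join s G) u v) t′)
    critical′ u v u≢v uv∉ with nonEdge-join⁻ s G (u≢v , uv∉)
    ... | u′ , v′ , refl , refl , u′≢v′ , u′v′∉ with critical u′ v′ u′≢v′ u′v′∉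
    ... | t′ , t′<t , μ̌ =
      t′ ∸ s , m<o⇒n<o⇒m∸n<o∸n t′<t s<t , MuIs-resp-≅ (join-addEdge s G u′ v′) (MuIs-join s μ̌)

  backward : InM (t ∸ s) (join s G) → InM t G
  backward (μ̌sG , critical) = MuIs-join⁻ s s<t μ̌sG , critical′
    where
    critical′ : ∀ u v → u ≢ v → adj G u v ≡ false → ∃[ t′ ] (t′ < t × MuIs (addEdge G u v) t′)
    critical′ u v u≢v uv∉ =
      let (u↑≢v↑ , u↑v↑∉) = nonEdge-join s G (u≢v , uv∉)
          (t′ , t′<t∸s , μ̌) = critical _ _ u↑≢v↑ u↑v↑∉
          (k , k≤t′+s , μ̌k) = MuIs-join-bound s (MuIs-resp-≅ (≅-sym (join-addEdge s G u v)) μ̌)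
      in k , ≤-<-trans k≤t′+s (m<o∸n⇒m+n<o t′<t∸s) , μ̌k
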